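{- Let $R$ be a consistent triple set and let $\{A',B'\},\{A,B\}$ be distinct elements of $\mathfrak L^*(R;R)$. If $A'\cap(A\cup B)\ne\emptyset$ and $B'\cap(A\cup B)\ne\emptyset$, then $A'\cup B'\subseteq A$ or $A'\cup B'\subseteq B$.
   Context: A rooted tree $T$ has a distinguished inner vertex (root); leaves are degree-1 vertices; inner vertices other than the root have degree at least 3. A triple $ab|c$ is the rooted binary tree on leaves $a,b,c$ where the path from $a$ to $b$ avoids the path from $c$ to the root; $ab|c=ba|c$. A rooted tree displays $ab|c$ if $a,b,c$ are leaves and the path from $a$ to $b$ does not intersect the path from $c$ to the root; $\mathcal R(T)$ is the set of displayed triples. A triple set is consistent if some rooted tree displays all its triples. $L_R$ is the set of leaves appearing in $R$. $\mathrm{cl}(R)=\bigcap\mathcal R(T)$ over all rooted trees $T$ with leaf set $L_R$ displaying $R$. For $\mathcal L\subseteq L_R$, the Ahograph $[R,\mathcal L]$ has vertex set $\mathcal L$, distinct $x,y\in\mathcal L$ adjacent iff some $xy|z\in R$ has $z\in\mathcal L$; connected components are identified with vertex sets. $\mathfrak L(ab|c;R)$ is the set of unordered pairs $\{A,B\}$, $A,B\subseteq L_R$, such that $[R,A\cup B]$ has exactly two connected components $A$ and $B$, one containing $a,b$ and the other $c$; for $ab|c\in\mathrm{cl}(R)$ it has a unique element maximizing $|A\cup B|$, denoted $\mathfrak L^*(ab|c;R)$. $\mathfrak L^*(R;R)=\{\mathfrak L^*(r;R): r\in R\}$. -}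

module Defs where

open import Data.Nat using (ℕ; _≤_)
open import Data.Fin using (Fin)
open import Data.Fin.Subset using (Subset; ⁅_⁆; _∈_; _⊆_; _∪_; ∣_∣; Nonempty; ⊥)
open import Data.List using (List; []; _∷_; _++_; [_]; length; foldr)
open import Data.List.Membership.Propositional using () renaming (_∈_ to _∈ₗ_)
open import Data.List.Relation.Unary.All using (All)
open import Data.List.Relation.Unary.Any using (Any)
open import Data.Product using (Σ; ∃; _×_; _,_)
open import Data.Sum using (_⊎_)
open import Relation.Binary.PropositionalEquality using (_≡_; _≢_)
open import Relation.Binary.Construct.Closure.ReflexiveTransitive using (Star)
open import Relation.Nullary using (¬_)

-- Leaves are labelled by Fin n.  A triple ab|c is a record (a , b , c);
-- ab|c = ba|c is handled by `SameTriple`.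

record Triple (n : ℕ) : Set where
  constructor triple
  field
    a b c : Fin n
open Triple public

SameTriple : ∀ {n} → Triple n → Triple n → Set
SameTriple s t =
  c s ≡ c t × ((a s ≡ a t × b s ≡ b t) ⊎ (a s ≡ b t × b s ≡ a t))

_∈T_ : ∀ {n} → Triple n → List (Triple n) → Set
t ∈T R = Any (λ s → SameTriple s t) R

leavesOf : ∀ {n} → List (Triple n) → Subset n
leavesOf {n} = foldr (λ t acc → ⁅ a t ⁆ ∪ (⁅ b t ⁆ ∪ (⁅ c t ⁆ ∪ acc))) ⊥

data Tree (n : ℕ) : Set where
  leaf : Fin n → Tree n
  node : List (Tree n) → Tree n

mutual
  leaves : ∀ {n} → Tree n → List (Fin n)
  leaves (leaf x)  = [ x ]
  leaves (node ts) = leavesL ts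

  leavesL : ∀ {n} → List (Tree n) → List (Fin n)
  leavesL []       = []
  leavesL (t ∷ ts) = leaves t ++ leavesL ts

-- s ≼ t : s is the subtree of t rooted at some vertex of t
data _≼_ {n : ℕ} : Tree n → Tree n → Set where
  here  : ∀ {t} → t ≼ t
  below : ∀ {s ts} → Any (s ≼_) ts → s ≼ node ts

-- every non-root inner vertex has degree ≥ 3, i.e. ≥ 2 children
data NonRootOK {n : ℕ} : Tree n → Set where
  leafOK : ∀ {x} → NonRootOK (leaf x)
  nodeOK : ∀ {ts} → 2 ≤ length ts → All NonRootOK ts → NonRootOK (node ts)

-- a rooted tree: the root is an inner vertex, all other inner vertices
-- have degree ≥ 3, and leaf labels are pairwise distinct
data UniqueL {n : ℕ} : List (Fin n) → Set where
  []  : UniqueL []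
  _∷_ : ∀ {x xs} → ¬ (x ∈ₗ xs) → UniqueL xs → UniqueL (x ∷ xs)

record RootedTree (n : ℕ) : Set where
  constructor rootedTree
  field
    children   : List (Tree n)
    childrenOK : All NonRootOK children
    distinct   : UniqueL (leavesL children)
  tree : Tree n
  tree = node children
open RootedTree public

-- T displays ab|c : a,b,c are (distinct) leaves and the path from a to b
-- avoids the path from c to the root, i.e. some vertex v has a,b below it
-- and c not below it.
Displays : ∀ {n} → RootedTree n → Triple n → Set
Displays T t =
  a t ≢ b t × a t ≢ c t × b t ≢ c t ×
  a t ∈ₗ leaves (tree T) × b t ∈ₗ leaves (tree T) × c t ∈ₗ leaves (tree T) ×
  ∃ λ s → s ≼ tree T × a t ∈ₗ leaves s × b t ∈ₗ leaves s × ¬ (c t ∈ₗ leaves s)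

Consistent : ∀ {n} → List (Triple n) → Set
Consistent {n} R = ∃ λ (T : RootedTree n) → All (Displays T) R

AhoAdj : ∀ {n} → List (Triple n) → Subset n → Fin n → Fin n → Set
AhoAdj R 𝓛 x y =
  x ∈ 𝓛 × y ∈ 𝓛 × x ≢ y × ∃ λ z → z ∈ 𝓛 × triple x y z ∈T R

AhoReach : ∀ {n} → List (Triple n) → Subset n → Fin n → Fin n → Set
AhoReach R 𝓛 = Star (AhoAdj R 𝓛)

IsComponent : ∀ {n} → List (Triple n) → Subset n → Subset n → Set
IsComponent R 𝓛 C =
  C ⊆ 𝓛 × Nonempty C ×
  (∀ {x y} → x ∈ C → y ∈ C → AhoReach R 𝓛 x y) ×
  (∀ {x y} → x ∈ C → AhoReach R 𝓛 x y → y ∈ C)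

ExactlyTwoComponents : ∀ {n} → List (Triple n) → Subset n → Subset n → Set
ExactlyTwoComponents R A B =
  A ≢ B × IsComponent R (A ∪ B) A × IsComponent R (A ∪ B) B ×
  (∀ C → IsComponent R (A ∪ B) C → C ≡ A ⊎ C ≡ B)

InFrakL : ∀ {n} → Triple n → List (Triple n) → Subset n → Subset n → Set
InFrakL t R A B =
  A ⊆ leavesOf R × B ⊆ leavesOf R × ExactlyTwoComponents R A B ×
  ((a t ∈ A × b t ∈ A × c t ∈ B) ⊎ (a t ∈ B × b t ∈ B × c t ∈ A))

IsFrakLStar : ∀ {n} → Triple n → List (Triple n) → Subset n → Subset n → Set
IsFrakLStar t R A B =
  InFrakL t R A B × (∀ A₂ B₂ → InFrakL t R A₂ B₂ → ∣ A₂ ∪ B₂ ∣ ≤ ∣ A ∪ B ∣)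

InFrakLStarR : ∀ {n} → List (Triple n) → Subset n → Subset n → Set
InFrakLStarR R A B = ∃ λ r → r ∈ₗ R × IsFrakLStar r R A B

SamePair : ∀ {n} → Subset n → Subset n → Subset n → Subset n → Set
SamePair A B A' B' = (A ≡ A' × B ≡ B') ⊎ (A ≡ B' × B ≡ A')

module Submission where

-- The engine is Aho's lemma: for consistent R and any leaf set M with at
-- least two elements, the Ahograph [R,M] is disconnected.  It is proved by
-- descending in a tree T displaying R: if x reaches every vertex of M,
-- then each vertex containing x and all M-leaves of T has a child with the
-- same property (an edge of [R,M] never leaves a child of such a vertex),
-- so finally the leaf x itself contains all of M.
-- Consequently, two sets G₁, G₂ that are each connected in [R, G₁ ∪ G₂]
-- are exactly its two components.  Enlarging {A,B} ∈ 𝔏*(r;R) to such a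
-- pair {G₁,G₂} with A ⊆ G₁, B ⊆ G₂ therefore gives an element of
-- 𝔏(r;R), and maximality forces G₁ ⊆ A and G₂ ⊆ B.  Taking x₁ ∈ A' ∩ A
-- and x₂ ∈ B' ∩ (A ∪ B), the choice G₁ = A ∪ A' ∪ B' (if x₂ ∈ A) gives the
-- claim, while G₁ = A ∪ A', G₂ = B ∪ B' (if x₂ ∈ B) gives {A',B'} = {A,B}.

open import Defs
open import Data.Nat using (ℕ)
open import Data.List using (List)
open import Data.Fin.Subset using (Subset; _∪_; _∩_; _⊆_; Nonempty)
open import Data.Sum using (_⊎_)
open import Relation.Nullary using (¬_)

open import Data.Nat using (_≤_)
open import Data.Nat.Properties using (<⇒≱)
open import Data.Fin using (Fin)
open import Data.Fin.Subset using (_∈_; ∣_∣)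
open import Data.Fin.Subset.Properties
  using (_∈?_; x∈p∪q⁺; x∈p∪q⁻; x∈p∩q⁻; ⊆-antisym; ∪-comm; p⊂q⇒∣p∣<∣q∣)
open import Data.List using ([]; _∷_; _++_)
open import Data.List.Membership.Propositional using () renaming (_∈_ to _∈ₗ_)
open import Data.List.Membership.Propositional.Properties using (∈-++⁺ˡ; ∈-++⁺ʳ; ∈-++⁻)
open import Data.List.Relation.Unary.All using (All; lookupAny)
open import Data.List.Relation.Unary.Any using (Any; here; there)
import Data.List.Relation.Unary.Any as Any
open import Data.Product using (∃; _×_; _,_; proj₁; proj₂; uncurry)
open import Data.Sum using (inj₁; inj₂; [_,_]; swap) renaming (map to ⊎-map)
open import Data.Empty using (⊥; ⊥-elim)
open import Function using (_∘_)
open import Relation.Binary.PropositionalEquality using (_≡_; _≢_; refl; sym; subst)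
open import Relation.Binary.Construct.Closure.ReflexiveTransitive using (ε; _◅_; _◅◅_; reverse)
import Relation.Binary.Construct.Closure.ReflexiveTransitive as Star
open import Relation.Nullary using (yes; no)

module _ {n : ℕ} where

  child-≼ : ∀ {c : Tree n} {ts} → c ∈ₗ ts → c ≼ node ts
  child-≼ c∈ts = below (Any.map (λ { refl → here }) c∈ts)

  mutual
    ≼-leaves : ∀ {x : Fin n} {s t} → s ≼ t → x ∈ₗ leaves s → x ∈ₗ leaves t
    ≼-leaves here       x∈s = x∈s
    ≼-leaves (below s≼) x∈s = ≼-leavesL s≼ x∈s

    ≼-leavesL : ∀ {x : Fin n} {s ts} → Any (s ≼_) ts → x ∈ₗ leaves s → x ∈ₗ leavesL ts
    ≼-leavesL (here s≼t)              x∈s = ∈-++⁺ˡ (≼-leaves s≼t x∈s)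
    ≼-leavesL {ts = t ∷ _} (there s≼) x∈s = ∈-++⁺ʳ (leaves t) (≼-leavesL s≼ x∈s)

  mutual
    ≼-trans : ∀ {s t u : Tree n} → s ≼ t → t ≼ u → s ≼ u
    ≼-trans s≼t here       = s≼t
    ≼-trans s≼t (below t≼) = below (≼-transL s≼t t≼)

    ≼-transL : ∀ {s t : Tree n} {ts} → s ≼ t → Any (t ≼_) ts → Any (s ≼_) ts
    ≼-transL s≼t (here t≼u)  = here (≼-trans s≼t t≼u)
    ≼-transL s≼t (there t≼)  = there (≼-transL s≼t t≼)

  mutual
    leaf-≼ : ∀ {x : Fin n} t → x ∈ₗ leaves t → leaf x ≼ t
    leaf-≼ (leaf _)  (here refl) = here
    leaf-≼ (node ts) x∈t         = below (leaf-≼L ts x∈t)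

    leaf-≼L : ∀ {x : Fin n} ts → x ∈ₗ leavesL ts → Any (leaf x ≼_) ts
    leaf-≼L (t ∷ ts) x∈ts with ∈-++⁻ (leaves t) x∈ts
    ... | inj₁ x∈t  = here (leaf-≼ t x∈t)
    ... | inj₂ x∈ts' = there (leaf-≼L ts x∈ts')

  leaf-label : ∀ {x y : Fin n} → y ∈ₗ leaves (leaf x) → y ≡ x
  leaf-label (here y≡x) = y≡x
  leaf-label (there ())

module _ {n : ℕ} where

  unique-++ˡ : ∀ (xs : List (Fin n)) {ys} → UniqueL (xs ++ ys) → UniqueL xs
  unique-++ˡ []       _            = []
  unique-++ˡ (x ∷ xs) (x∉ ∷ uniq) = (x∉ ∘ ∈-++⁺ˡ) ∷ unique-++ˡ xs uniq

  unique-++ʳ : ∀ (xs : List (Fin n)) {ys} → UniqueL (xs ++ ys) → UniqueL ys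
  unique-++ʳ []       uniq       = uniq
  unique-++ʳ (x ∷ xs) (_ ∷ uniq) = unique-++ʳ xs uniq

  unique-++-disjoint : ∀ (xs : List (Fin n)) {ys} {y} → UniqueL (xs ++ ys) →
                       y ∈ₗ xs → y ∈ₗ ys → ⊥
  unique-++-disjoint (x ∷ xs) (x∉ ∷ _)    (here refl) y∈ys = x∉ (∈-++⁺ʳ xs y∈ys)
  unique-++-disjoint (x ∷ xs) (_ ∷ uniq) (there y∈xs) y∈ys = unique-++-disjoint xs uniq y∈xs y∈ys

  mutual
    unique-≼ : ∀ {s t : Tree n} → s ≼ t → UniqueL (leaves t) → UniqueL (leaves s)
    unique-≼ here       uniq = uniq
    unique-≼ (below s≼) uniq = unique-≼L s≼ uniq

    unique-≼L : ∀ {s : Tree n} {ts} → Any (s ≼_) ts → UniqueL (leavesL ts) → UniqueL (leaves s)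
    unique-≼L {ts = t ∷ _} (here s≼t) uniq = unique-≼ s≼t (unique-++ˡ (leaves t) uniq)
    unique-≼L {ts = t ∷ _} (there s≼) uniq = unique-≼L s≼ (unique-++ʳ (leaves t) uniq)

-- Laminarity: in a tree with distinct leaf labels, vertices sharing a leaf
-- are nested.

module _ {n : ℕ} where

  mutual
    ≼-nested : ∀ {x : Fin n} {s v t} → s ≼ t → v ≼ t → UniqueL (leaves t) →
               x ∈ₗ leaves s → x ∈ₗ leaves v → s ≼ v ⊎ v ≼ s
    ≼-nested here        v≼t       _    _ _ = inj₂ v≼t
    ≼-nested (below s≼)  here      _    _ _ = inj₁ (below s≼)
    ≼-nested (below s≼)  (below v≼) uniq x∈s x∈v = ≼-nestedL s≼ v≼ uniq x∈s x∈v

    ≼-nestedL : ∀ {x : Fin n} {s v ts} → Any (s ≼_) ts → Any (v ≼_) ts →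
                UniqueL (leavesL ts) → x ∈ₗ leaves s → x ∈ₗ leaves v → s ≼ v ⊎ v ≼ s
    ≼-nestedL {ts = t ∷ _} (here s≼t) (here v≼t) uniq x∈s x∈v =
      ≼-nested s≼t v≼t (unique-++ˡ (leaves t) uniq) x∈s x∈v
    ≼-nestedL {ts = t ∷ _} (here s≼t) (there v≼) uniq x∈s x∈v =
      ⊥-elim (unique-++-disjoint (leaves t) uniq (≼-leaves s≼t x∈s) (≼-leavesL v≼ x∈v))
    ≼-nestedL {ts = t ∷ _} (there s≼) (here v≼t) uniq x∈s x∈v =
      ⊥-elim (unique-++-disjoint (leaves t) uniq (≼-leaves v≼t x∈v) (≼-leavesL s≼ x∈s))
    ≼-nestedL {ts = t ∷ _} (there s≼) (there v≼) uniq x∈s x∈v =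
      ≼-nestedL s≼ v≼ (unique-++ʳ (leaves t) uniq) x∈s x∈v

  ≼-sameChild : ∀ {x : Fin n} {s c ts} → Any (s ≼_) ts → c ∈ₗ ts → UniqueL (leavesL ts) →
                x ∈ₗ leaves s → x ∈ₗ leaves c → s ≼ c
  ≼-sameChild (here s≼c) (here refl) _ _ _ = s≼c
  ≼-sameChild {ts = t ∷ _} (here s≼t) (there c∈) uniq x∈s x∈c =
    ⊥-elim (unique-++-disjoint (leaves t) uniq (≼-leaves s≼t x∈s) (≼-leaves (child-≼ c∈) x∈c))
  ≼-sameChild {ts = t ∷ _} (there s≼) (here refl) uniq x∈s x∈c =
    ⊥-elim (unique-++-disjoint (leaves t) uniq x∈c (≼-leavesL s≼ x∈s))
  ≼-sameChild {ts = t ∷ _} (there s≼) (there c∈) uniq x∈s x∈c =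
    ≼-sameChild s≼ c∈ (unique-++ʳ (leaves t) uniq) x∈s x∈c

  ≼-child-or-above : ∀ {x : Fin n} {s c ts t} → node ts ≼ t → c ∈ₗ ts → s ≼ t →
                     UniqueL (leaves t) → x ∈ₗ leaves s → x ∈ₗ leaves c →
                     s ≼ c ⊎ node ts ≼ s
  ≼-child-or-above v≼t c∈ s≼t uniq x∈s x∈c
    with ≼-nested s≼t v≼t uniq x∈s (≼-leaves (child-≼ c∈) x∈c)
  ... | inj₂ v≼s         = inj₂ v≼s
  ... | inj₁ here        = inj₂ here
  ... | inj₁ (below s≼)  = inj₁ (≼-sameChild s≼ c∈ (unique-≼ v≼t uniq) x∈s x∈c)

module _ {n : ℕ} where

  Separates : RootedTree n → Fin n → Fin n → Fin n → Set
  Separates T u u' z =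
    ∃ λ s → s ≼ tree T × u ∈ₗ leaves s × u' ∈ₗ leaves s × ¬ (z ∈ₗ leaves s)

  Shows : RootedTree n → Fin n → Fin n → Fin n → Set
  Shows T u u' z =
    u ∈ₗ leaves (tree T) × u' ∈ₗ leaves (tree T) × z ∈ₗ leaves (tree T) × Separates T u u' z

  shows : ∀ (T : RootedTree n) {s u u' z} → Displays T s → SameTriple s (triple u u' z) →
          Shows T u u' z
  shows _ (_ , _ , _ , aT , bT , cT , v , v≼T , a∈v , b∈v , c∉v) (refl , inj₁ (refl , refl)) =
    aT , bT , cT , v , v≼T , a∈v , b∈v , c∉v
  shows _ (_ , _ , _ , aT , bT , cT , v , v≼T , a∈v , b∈v , c∉v) (refl , inj₂ (refl , refl)) =
    bT , aT , cT , v , v≼T , b∈v , a∈v , c∉v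

  displayed : ∀ (T : RootedTree n) {R u u' z} → All (Displays T) R → triple u u' z ∈T R →
              Shows T u u' z
  displayed T disp uu'|z = uncurry (shows T) (lookupAny disp uu'|z)

-- The descent behind Aho's lemma, in a fixed tree T displaying R: if x
-- reaches all of M in [R,M], every vertex above x below a vertex covering
-- the M-leaves of T covers them as well.

module AhoSeparation {n : ℕ} (R : List (Triple n)) (T : RootedTree n)
                     (disp : All (Displays T) R) (M : Subset n) where

  adj-leaves : ∀ {u u'} → AhoAdj R M u u' → u ∈ₗ leaves (tree T) × u' ∈ₗ leaves (tree T)
  adj-leaves (_ , _ , _ , _ , _ , uu'|z) with displayed T disp uu'|z
  ... | uT , u'T , _ = uT , u'T

  reach-leaf : ∀ {u w} → AhoReach R M u w → u ∈ₗ leaves (tree T) → w ∈ₗ leaves (tree T)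
  reach-leaf ε          uT = uT
  reach-leaf (uu' ◅ u'w) _ = reach-leaf u'w (proj₂ (adj-leaves uu'))

  Covers : Tree n → Set
  Covers v = ∀ {w} → w ∈ M → w ∈ₗ leaves (tree T) → w ∈ₗ leaves v

  -- an edge u u' of [R,M] (from a triple uu'|z, z ∈ M) never leaves a child
  -- c of a covering vertex v: the separating vertex is below c, as it cannot
  -- be above v ∋ z
  adj-stays-in-child : ∀ {ts c} → node ts ≼ tree T → Covers (node ts) → c ∈ₗ ts →
                       ∀ {u u'} → AhoAdj R M u u' → u ∈ₗ leaves c → u' ∈ₗ leaves c
  adj-stays-in-child v≼T cov c∈ (_ , _ , _ , z , z∈M , uu'|z) u∈c
    with displayed T disp uu'|z
  ... | _ , _ , zT , s , s≼T , u∈s , u'∈s , z∉s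
    with ≼-child-or-above v≼T c∈ s≼T (distinct T) u∈s u∈c
  ... | inj₁ s≼c = ≼-leaves s≼c u'∈s
  ... | inj₂ v≼s = ⊥-elim (z∉s (≼-leaves v≼s (cov z∈M zT)))

  reach-stays-in-child : ∀ {ts c} → node ts ≼ tree T → Covers (node ts) → c ∈ₗ ts →
                         ∀ {u w} → AhoReach R M u w → u ∈ₗ leaves c → w ∈ₗ leaves c
  reach-stays-in-child v≼T cov c∈ ε           u∈c = u∈c
  reach-stays-in-child v≼T cov c∈ (uu' ◅ u'w) u∈c =
    reach-stays-in-child v≼T cov c∈ u'w (adj-stays-in-child v≼T cov c∈ uu' u∈c)

  module _ {x : Fin n} (reachAll : ∀ {w} → w ∈ M → AhoReach R M x w) where

    child-covers : ∀ {ts c} → node ts ≼ tree T → Covers (node ts) → c ∈ₗ ts →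
                   x ∈ₗ leaves c → Covers c
    child-covers v≼T cov c∈ x∈c w∈M _ = reach-stays-in-child v≼T cov c∈ (reachAll w∈M) x∈c

    mutual
      covers-below : ∀ {s v} → s ≼ v → v ≼ tree T → Covers v → x ∈ₗ leaves s → Covers s
      covers-below here       _   cov _   = cov
      covers-below (below s≼) v≼T cov x∈s = covers-belowL s≼ (λ c∈ → c∈) v≼T cov x∈s

      covers-belowL : ∀ {s ts₀ ts} → Any (s ≼_) ts → (∀ {c} → c ∈ₗ ts → c ∈ₗ ts₀) →
                      node ts₀ ≼ tree T → Covers (node ts₀) → x ∈ₗ leaves s → Covers s
      covers-belowL {ts₀ = ts₀} {ts = c ∷ _} (here s≼c) sub v≼T cov x∈s =
        covers-below s≼c (≼-trans (child-≼ c∈) v≼T)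
                     (child-covers v≼T cov c∈ (≼-leaves s≼c x∈s)) x∈s
        where
        c∈ : c ∈ₗ ts₀
        c∈ = sub (here refl)
      covers-belowL (there s≼) sub v≼T cov x∈s = covers-belowL s≼ (sub ∘ there) v≼T cov x∈s

aho-disconnected : ∀ {n} {R : List (Triple n)} {M : Subset n} {x y : Fin n} →
                   Consistent R → y ∈ M → x ≢ y →
                   ¬ (∀ {w} → w ∈ M → AhoReach R M x w)
aho-disconnected {R = R} {M} {x} {y} (T , disp) y∈M x≢y reachAll =
  x≢y (sym (leaf-label y∈leaf-x))
  where
  open AhoSeparation R T disp M
  x-leaf : ∀ {w} → AhoReach R M x w → x ≢ w → x ∈ₗ leaves (tree T)
  x-leaf ε          x≢x = ⊥-elim (x≢x refl)
  x-leaf (xu ◅ _)   _   = proj₁ (adj-leaves xu)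
  xT : x ∈ₗ leaves (tree T)
  xT = x-leaf (reachAll y∈M) x≢y
  -- the leaf x covers M, so it contains y
  y∈leaf-x : y ∈ₗ leaves (leaf x)
  y∈leaf-x = covers-below reachAll (leaf-≼ (tree T) xT) here (λ _ w∈T → w∈T) (here refl)
                          y∈M (reach-leaf (reachAll y∈M) xT)

module _ {n : ℕ} where

  ∈∪ˡ : ∀ {x : Fin n} {P Q} → x ∈ P → x ∈ P ∪ Q
  ∈∪ˡ = x∈p∪q⁺ ∘ inj₁

  ∈∪ʳ : ∀ {x : Fin n} {P Q} → x ∈ Q → x ∈ P ∪ Q
  ∈∪ʳ = x∈p∪q⁺ ∘ inj₂

  ∪-least : ∀ {P Q X : Subset n} → P ⊆ X → Q ⊆ X → P ∪ Q ⊆ X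
  ∪-least {P} {Q} P⊆X Q⊆X = [ P⊆X , Q⊆X ] ∘ x∈p∪q⁻ P Q

  ∪-mono : ∀ {P Q P' Q' : Subset n} → P ⊆ P' → Q ⊆ Q' → P ∪ Q ⊆ P' ∪ Q'
  ∪-mono P⊆P' Q⊆Q' = ∪-least (∈∪ˡ ∘ P⊆P') (∈∪ʳ ∘ Q⊆Q')

  ⊆-by-size : ∀ {S X : Subset n} → S ⊆ X → ∣ X ∣ ≤ ∣ S ∣ → X ⊆ S
  ⊆-by-size {S} S⊆X ∣X∣≤∣S∣ {u} u∈X with u ∈? S
  ... | yes u∈S = u∈S
  ... | no  u∉S = ⊥-elim (<⇒≱ (p⊂q⇒∣p∣<∣q∣ (S⊆X , u , u∈X , u∉S)) ∣X∣≤∣S∣)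

module _ {n : ℕ} {R : List (Triple n)} where

  adj-sym : ∀ {M x y} → AhoAdj R M x y → AhoAdj R M y x
  adj-sym (x∈ , y∈ , x≢y , z , z∈ , xy|z) =
    y∈ , x∈ , x≢y ∘ sym , z , z∈ , Any.map swapIngroup xy|z
    where
    swapIngroup : ∀ {s x y z} → SameTriple s (triple x y z) → SameTriple s (triple y x z)
    swapIngroup (c≡ , ab≡) = c≡ , swap ab≡

  reach-sym : ∀ {M x y} → AhoReach R M x y → AhoReach R M y x
  reach-sym = reverse adj-sym

  reach-mono : ∀ {L M} → L ⊆ M → ∀ {x y} → AhoReach R L x y → AhoReach R M x y
  reach-mono L⊆M = Star.map λ { (x∈ , y∈ , x≢y , z , z∈ , xy|z) →
                                  L⊆M x∈ , L⊆M y∈ , x≢y , z , L⊆M z∈ , xy|z }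

  reach-closed : ∀ {M x y} → x ∈ M → AhoReach R M x y → y ∈ M
  reach-closed x∈ ε              = x∈
  reach-closed _  ((_ , y∈ , _) ◅ yz) = reach-closed y∈ yz

  component-≡ : ∀ {M G C c} → IsComponent R M G → IsComponent R M C → c ∈ C → c ∈ G → C ≡ G
  component-≡ (_ , _ , withinG , closedG) (_ , _ , withinC , closedC) c∈C c∈G =
    ⊆-antisym (λ u∈C → closedG c∈G (withinC c∈C u∈C))
              (λ u∈G → closedC c∈C (withinG c∈G u∈G))

  components-disjoint : ∀ {A B x} → ExactlyTwoComponents R A B → x ∈ A → x ∈ B → ⊥
  components-disjoint (A≢B , compA , compB , _) x∈A x∈B = A≢B (component-≡ compB compA x∈A x∈B)

  exactlyTwo-swap : ∀ {A B} → ExactlyTwoComponents R A B → ExactlyTwoComponents R B A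
  exactlyTwo-swap {A} {B} (A≢B , compA , compB , onlyAB) =
    A≢B ∘ sym , move (∪-comm A B) compB , move (∪-comm A B) compA ,
    λ C compC → swap (onlyAB C (move (∪-comm B A) compC))
    where
    move : ∀ {L L' C} → L ≡ L' → IsComponent R L C → IsComponent R L' C
    move refl compC = compC

Linked : ∀ {n} → List (Triple n) → Subset n → Subset n → Fin n → Set
Linked R M G g = ∀ {u} → u ∈ G → AhoReach R M g u

module _ {n : ℕ} {R : List (Triple n)} where

  component-linked : ∀ {L M C g} → IsComponent R L C → L ⊆ M → g ∈ C → Linked R M C g
  component-linked (_ , _ , withinC , _) L⊆M g∈C u∈C = reach-mono L⊆M (withinC g∈C u∈C)

  linked-∪ : ∀ {M P Q g h} → Linked R M P g → Linked R M Q h → AhoReach R M g h →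
             Linked R M (P ∪ Q) g
  linked-∪ {P = P} {Q} linkP linkQ g⇝h u∈ =
    [ linkP , (λ u∈Q → g⇝h ◅◅ linkQ u∈Q) ] (x∈p∪q⁻ P Q u∈)

  -- two sets, each linked in [R, G₁ ∪ G₂] from distinct base points, are
  -- exactly its two components, because by Aho's lemma g₁ cannot reach g₂
  twoComponents : Consistent R → ∀ {G₁ G₂ g₁ g₂} → g₁ ∈ G₁ → g₂ ∈ G₂ → g₁ ≢ g₂ →
                  Linked R (G₁ ∪ G₂) G₁ g₁ → Linked R (G₁ ∪ G₂) G₂ g₂ →
                  ExactlyTwoComponents R G₁ G₂
  twoComponents con {G₁} {G₂} {g₁} {g₂} g₁∈ g₂∈ g₁≢g₂ link₁ link₂ =
    G₁≢G₂ , comp₁ , comp₂ , only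
    where
    ¬g₁⇝g₂ : ¬ AhoReach R (G₁ ∪ G₂) g₁ g₂
    ¬g₁⇝g₂ g₁⇝g₂ = aho-disconnected con (∈∪ʳ g₂∈) g₁≢g₂ (linked-∪ link₁ link₂ g₁⇝g₂)
    closed₁ : ∀ {x y} → x ∈ G₁ → AhoReach R (G₁ ∪ G₂) x y → y ∈ G₁
    closed₁ x∈ x⇝y with x∈p∪q⁻ G₁ G₂ (reach-closed (∈∪ˡ x∈) x⇝y)
    ... | inj₁ y∈₁ = y∈₁
    ... | inj₂ y∈₂ = ⊥-elim (¬g₁⇝g₂ (link₁ x∈ ◅◅ x⇝y ◅◅ reach-sym (link₂ y∈₂)))
    closed₂ : ∀ {x y} → x ∈ G₂ → AhoReach R (G₁ ∪ G₂) x y → y ∈ G₂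
    closed₂ x∈ x⇝y with x∈p∪q⁻ G₁ G₂ (reach-closed (∈∪ʳ x∈) x⇝y)
    ... | inj₂ y∈₂ = y∈₂
    ... | inj₁ y∈₁ = ⊥-elim (¬g₁⇝g₂ (link₁ y∈₁ ◅◅ reach-sym x⇝y ◅◅ reach-sym (link₂ x∈)))
    comp₁ : IsComponent R (G₁ ∪ G₂) G₁
    comp₁ = ∈∪ˡ , (g₁ , g₁∈) , (λ x∈ y∈ → reach-sym (link₁ x∈) ◅◅ link₁ y∈) , closed₁
    comp₂ : IsComponent R (G₁ ∪ G₂) G₂
    comp₂ = ∈∪ʳ , (g₂ , g₂∈) , (λ x∈ y∈ → reach-sym (link₂ x∈) ◅◅ link₂ y∈) , closed₂
    G₁≢G₂ : G₁ ≢ G₂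
    G₁≢G₂ G₁≡G₂ = ¬g₁⇝g₂ (link₁ (subst (g₂ ∈_) (sym G₁≡G₂) g₂∈))
    only : ∀ C → IsComponent R (G₁ ∪ G₂) C → C ≡ G₁ ⊎ C ≡ G₂
    only C compC@(C⊆ , (c , c∈C) , _) with x∈p∪q⁻ G₁ G₂ (C⊆ c∈C)
    ... | inj₁ c∈₁ = inj₁ (component-≡ comp₁ compC c∈C c∈₁)
    ... | inj₂ c∈₂ = inj₂ (component-≡ comp₂ compC c∈C c∈₂)

module _ {n : ℕ} {R : List (Triple n)} {r : Triple n} where

  frakLStar-swap : ∀ {A B} → IsFrakLStar r R A B → IsFrakLStar r R B A
  frakLStar-swap {A} {B} ((A⊆ , B⊆ , two , sides) , maximal) =
    (B⊆ , A⊆ , exactlyTwo-swap two , swap sides) ,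
    λ A₂ B₂ inL → subst (λ L → ∣ A₂ ∪ B₂ ∣ ≤ ∣ L ∣) (∪-comm A B) (maximal A₂ B₂ inL)

  frakL-enlarge : ∀ {A B G₁ G₂} → InFrakL r R A B → A ⊆ G₁ → B ⊆ G₂ →
                  G₁ ⊆ leavesOf R → G₂ ⊆ leavesOf R → ExactlyTwoComponents R G₁ G₂ →
                  InFrakL r R G₁ G₂
  frakL-enlarge {A} {B} {G₁} {G₂} (_ , _ , _ , sides) A⊆G₁ B⊆G₂ G₁⊆ G₂⊆ two =
    G₁⊆ , G₂⊆ , two , ⊎-map enlarge₁ enlarge₂ sides
    where
    enlarge₁ : a r ∈ A × b r ∈ A × c r ∈ B → a r ∈ G₁ × b r ∈ G₁ × c r ∈ G₂
    enlarge₁ (a∈ , b∈ , c∈) = A⊆G₁ a∈ , A⊆G₁ b∈ , B⊆G₂ c∈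
    enlarge₂ : a r ∈ B × b r ∈ B × c r ∈ A → a r ∈ G₂ × b r ∈ G₂ × c r ∈ G₁
    enlarge₂ (a∈ , b∈ , c∈) = B⊆G₂ a∈ , B⊆G₂ b∈ , A⊆G₁ c∈

  frakLStar-absorbs : ∀ {A B G₁ G₂} → IsFrakLStar r R A B → A ⊆ G₁ → B ⊆ G₂ →
                      G₁ ⊆ leavesOf R → G₂ ⊆ leavesOf R → ExactlyTwoComponents R G₁ G₂ →
                      G₁ ⊆ A × G₂ ⊆ B
  frakLStar-absorbs {A} {B} {G₁} {G₂} (inL , maximal) A⊆G₁ B⊆G₂ G₁⊆ G₂⊆ two =
    (λ u∈₁ → [ (λ u∈A → u∈A) , (λ u∈B → ⊥-elim (components-disjoint two u∈₁ (B⊆G₂ u∈B))) ]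
               (inAB (∈∪ˡ u∈₁))) ,
    (λ u∈₂ → [ (λ u∈A → ⊥-elim (components-disjoint two (A⊆G₁ u∈A) u∈₂)) , (λ u∈B → u∈B) ]
               (inAB (∈∪ʳ u∈₂)))
    where
    inAB : ∀ {u} → u ∈ G₁ ∪ G₂ → u ∈ A ⊎ u ∈ B
    inAB u∈ = x∈p∪q⁻ A B (⊆-by-size (∪-mono A⊆G₁ B⊆G₂)
                 (maximal _ _ (frakL-enlarge inL A⊆G₁ B⊆G₂ G₁⊆ G₂⊆ two)) u∈)

module _ {n : ℕ} {R : List (Triple n)} {r' r : Triple n} where

  -- x₂ ∈ A: then A ∪ A' ∪ B' and B are the components of their union
  nested-case : Consistent R → ∀ {A' B' A B x₁ x₂} →
                InFrakL r' R A' B' → IsFrakLStar r R A B →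
                x₁ ∈ A' → x₁ ∈ A → x₂ ∈ B' → x₂ ∈ A → A' ∪ B' ⊆ A
  nested-case con {A'} {B'} {A} {B} {x₁} (A'⊆ , B'⊆ , (_ , compA' , compB' , _) , _)
              star@((A⊆ , B⊆ , two@(_ , compA , compB@(_ , (b₀ , b₀∈B) , _) , _) , _) , _)
              x₁∈A' x₁∈A x₂∈B' x₂∈A =
    proj₁ (frakLStar-absorbs star ∈∪ˡ (λ u∈ → u∈) (∪-least A⊆ (∪-least A'⊆ B'⊆)) B⊆ two')
    ∘ ∈∪ʳ
    where
    AB⊆ : A ∪ B ⊆ (A ∪ (A' ∪ B')) ∪ B
    AB⊆ = ∪-mono ∈∪ˡ (λ u∈ → u∈)
    A'B'⊆ : A' ∪ B' ⊆ (A ∪ (A' ∪ B')) ∪ B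
    A'B'⊆ = ∈∪ˡ ∘ ∈∪ʳ
    x₁≢b₀ : x₁ ≢ b₀
    x₁≢b₀ refl = components-disjoint two x₁∈A b₀∈B
    two' : ExactlyTwoComponents R (A ∪ (A' ∪ B')) B
    two' = twoComponents con (∈∪ˡ x₁∈A) b₀∈B x₁≢b₀
             (linked-∪ (component-linked compA AB⊆ x₁∈A)
                       (linked-∪ (component-linked compA' A'B'⊆ x₁∈A')
                                 (component-linked compB' A'B'⊆ x₂∈B')
                                 (component-linked compA AB⊆ x₁∈A x₂∈A))
                       ε)
             (component-linked compB AB⊆ b₀∈B)

  -- x₂ ∈ B: then A ∪ A' and B ∪ B' are components, and maximality of both
  -- pairs forces {A',B'} = {A,B}
  aligned-case : Consistent R → ∀ {A' B' A B x₁ x₂} →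
                 IsFrakLStar r' R A' B' → IsFrakLStar r R A B →
                 x₁ ∈ A' → x₁ ∈ A → x₂ ∈ B' → x₂ ∈ B → A' ≡ A × B' ≡ B
  aligned-case con {A'} {B'} {A} {B} {x₁} {x₂}
               star'@((A'⊆ , B'⊆ , (_ , compA' , compB' , _) , _) , _)
               star@((A⊆ , B⊆ , two@(_ , compA , compB , _) , _) , _)
               x₁∈A' x₁∈A x₂∈B' x₂∈B =
    ⊆-antisym (G₁⊆A ∘ ∈∪ʳ) (G₁⊆A' ∘ ∈∪ˡ) , ⊆-antisym (G₂⊆B ∘ ∈∪ʳ) (G₂⊆B' ∘ ∈∪ˡ)
    where
    AB⊆ : A ∪ B ⊆ (A ∪ A') ∪ (B ∪ B')
    AB⊆ = ∪-mono ∈∪ˡ ∈∪ˡ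
    A'B'⊆ : A' ∪ B' ⊆ (A ∪ A') ∪ (B ∪ B')
    A'B'⊆ = ∪-mono ∈∪ʳ ∈∪ʳ
    x₁≢x₂ : x₁ ≢ x₂
    x₁≢x₂ refl = components-disjoint two x₁∈A x₂∈B
    two' : ExactlyTwoComponents R (A ∪ A') (B ∪ B')
    two' = twoComponents con (∈∪ˡ x₁∈A) (∈∪ˡ x₂∈B) x₁≢x₂
             (linked-∪ (component-linked compA AB⊆ x₁∈A) (component-linked compA' A'B'⊆ x₁∈A') ε)
             (linked-∪ (component-linked compB AB⊆ x₂∈B) (component-linked compB' A'B'⊆ x₂∈B') ε)
    G₁⊆ : A ∪ A' ⊆ leavesOf R
    G₁⊆ = ∪-least A⊆ A'⊆
    G₂⊆ : B ∪ B' ⊆ leavesOf R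
    G₂⊆ = ∪-least B⊆ B'⊆
    absorbed : A ∪ A' ⊆ A × B ∪ B' ⊆ B
    absorbed = frakLStar-absorbs star ∈∪ˡ ∈∪ˡ G₁⊆ G₂⊆ two'
    absorbed' : A ∪ A' ⊆ A' × B ∪ B' ⊆ B'
    absorbed' = frakLStar-absorbs star' ∈∪ʳ ∈∪ʳ G₁⊆ G₂⊆ two'
    G₁⊆A : A ∪ A' ⊆ A
    G₁⊆A = proj₁ absorbed
    G₂⊆B : B ∪ B' ⊆ B
    G₂⊆B = proj₂ absorbed
    G₁⊆A' : A ∪ A' ⊆ A'
    G₁⊆A' = proj₁ absorbed'
    G₂⊆B' : B ∪ B' ⊆ B'
    G₂⊆B' = proj₂ absorbed'

mainTheorem14 : (n : ℕ) (R : List (Triple n)) → Consistent R →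
    (A' B' A B : Subset n) →
    InFrakLStarR R A' B' → InFrakLStarR R A B → ¬ SamePair A' B' A B →
    Nonempty (A' ∩ (A ∪ B)) → Nonempty (B' ∩ (A ∪ B)) →
    (A' ∪ B') ⊆ A ⊎ (A' ∪ B') ⊆ B
mainTheorem14 n R con A' B' A B (_ , _ , star') (_ , _ , star) notSame (x₁ , x₁∈) (x₂ , x₂∈)
  with x∈p∩q⁻ A' (A ∪ B) x₁∈ | x∈p∩q⁻ B' (A ∪ B) x₂∈
... | x₁∈A' , x₁∈AB | x₂∈B' , x₂∈AB with x∈p∪q⁻ A B x₁∈AB | x∈p∪q⁻ A B x₂∈AB
... | inj₁ x₁∈A | inj₁ x₂∈A =
  inj₁ (nested-case con (proj₁ star') star x₁∈A' x₁∈A x₂∈B' x₂∈A)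
... | inj₂ x₁∈B | inj₂ x₂∈B =
  inj₂ (nested-case con (proj₁ star') (frakLStar-swap star) x₁∈A' x₁∈B x₂∈B' x₂∈B)
... | inj₁ x₁∈A | inj₂ x₂∈B =
  ⊥-elim (notSame (inj₁ (aligned-case con star' star x₁∈A' x₁∈A x₂∈B' x₂∈B)))
... | inj₂ x₁∈B | inj₁ x₂∈A =
  ⊥-elim (notSame (inj₂ (aligned-case con star' (frakLStar-swap star) x₁∈A' x₁∈B x₂∈B' x₂∈A)))
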